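{- Let $\sigma\ge2$ be an even integer. Then $v(w_\sigma^R)=2\sigma-1$.
   Context: Let $\Sigma=\{a_1,\dots,a_\sigma\}$ with $a_1<\cdots<a_\sigma$, and $w_\sigma=\left(\prod_{i=1}^{\sigma-1}a_ia_{i+1}\right)\left(\prod_{i=1}^{\sigma}a_i\right)$ (concatenation in increasing $i$); $w_\sigma^R$ is its reverse. Strings are compared lexicographically. The lex-parse of a string $w$ of length $n$ is the factorization $w=x_1\cdots x_v$ defined left to right: if phrase $x_j$ starts at position $i=1+\sum_{t<j}|x_t|$, its length is $\max\{1,\ell\}$, where $\ell$ is the length of the longest common prefix of $w[i\ldots n]$ with the suffix of $w$ immediately preceding it in lexicographic order among all suffixes of $w$ ($\ell=0$ if $w[i\ldots n]$ is the smallest suffix). $v(w)$ is the number of phrases. -}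

module Defs where

open import Data.Nat using (ℕ; zero; suc; _+_; _∸_; _<ᵇ_; _≤ᵇ_; _⊔_)
open import Data.Bool using (Bool; true; false; if_then_else_)
open import Data.List using (List; []; _∷_; _++_; map; concatMap; upTo; drop; length; reverse; foldr)
open import Data.Maybe using (Maybe; just; nothing; maybe)

-- Alphabet: letter a_i is encoded as the natural number i, so a_1 < ... < a_σ
-- is the usual order on ℕ. Strings are lists of letters.
Str : Set
Str = List ℕ

lexLt : Str → Str → Bool
lexLt []       []       = false
lexLt []       (_ ∷ _)  = true
lexLt (_ ∷ _)  []       = false
lexLt (x ∷ xs) (y ∷ ys) =
  if x <ᵇ y then true else (if y <ᵇ x then false else lexLt xs ys)

lcp : Str → Str → ℕ
lcp (x ∷ xs) (y ∷ ys) = if (x <ᵇ y) then 0 else (if (y <ᵇ x) then 0 else suc (lcp xs ys))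
lcp _ _ = 0

-- w_σ = (∏_{i=1}^{σ-1} a_i a_{i+1}) (∏_{i=1}^{σ} a_i)
w : ℕ → Str
w σ = concatMap (λ i → suc i ∷ suc (suc i) ∷ []) (upTo (σ ∸ 1)) ++ map suc (upTo σ)

suffixes : Str → List Str
suffixes s = map (λ i → drop i s) (upTo (length s))

predecessor : Str → List Str → Maybe Str
predecessor cur = foldr step nothing
  where
  step : Str → Maybe Str → Maybe Str
  step s best = if lexLt s cur
                then (maybe (λ b → if lexLt b s then just s else just b) (just s) best)
                else best

ellAt : Str → ℕ → ℕ
ellAt s i = maybe (lcp (drop i s)) 0 (predecessor (drop i s) (suffixes s))

parseFrom : Str → ℕ → ℕ → ℕ
parseFrom s zero    i = 0
parseFrom s (suc f) i =
  if length s ≤ᵇ i then 0 else suc (parseFrom s f (i + (1 ⊔ ellAt s i)))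

-- v(w): number of phrases of the lex-parse (each phrase has length ≥ 1,
-- so fuel length w suffices)
v : Str → ℕ
v s = parseFrom s (length s) 0

{-# OPTIONS --safe #-}
-- Write wᴿ = σ(σ−1)⋯1 · σ(σ−1)(σ−1)(σ−2)⋯21. The ℓ of a phrase starting with letter h is the
-- longest common prefix with a lexicographically smaller suffix, and only suffixes starting
-- with h matter: h(h−1)(h−2)⋯ from the first block, h(h−1)(h−1)⋯ and hh(h−1)⋯ from the
-- second. Comparing these three, each letter h ≥ 3 of the first block is a phrase of length 1,
-- then 21 is one phrase (matched by the final 21); each pair h(h−1), h ≥ 3, of the second
-- block is one phrase (matched by h(h−1)(h−2)⋯), and the final 2 and 1 are single phrases:
-- (σ−2) + 1 + (σ−2) + 2 = 2σ − 1 phrases in all.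
module Submission where

open import Defs
open import Data.Nat using (ℕ; zero; suc; _+_; _*_; _∸_; _<ᵇ_; _≤ᵇ_; _⊔_; _≤_; _<_; _≤′_; ≤′-refl; ≤′-step; z≤n; s≤s)
open import Data.Nat.Properties
  using (≤-refl; ≤-trans; ≤-antisym; ≤-pred; <⇒≤; <-cmp; _≟_; +-assoc; +-comm; +-suc; +-identityʳ; m≥n⇒m⊔n≡m; ≤⇒≤′)
open import Data.Nat.Divisibility using (_∣_)
open import Data.Bool using (true; false; if_then_else_)
open import Data.Bool.Properties using (if-cong)
open import Data.List using (List; []; _∷_; _++_; map; reverse; drop; length; concat; upTo; applyUpTo; applyDownFrom; _∷ʳ_; concatMap)
open import Data.List.Properties
  using (reverse-++; map-upTo; map-applyUpTo; reverse-applyUpTo; applyUpTo-∷ʳ; concat-++; drop-drop; length-++; length-applyDownFrom)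
open import Data.List.Relation.Unary.All as All using (All; []; _∷_; lookup; universal)
open import Data.List.Relation.Unary.Any using (here; there)
open import Data.List.Membership.Propositional using (_∈_)
open import Data.Maybe using (Maybe; just; nothing; maybe)
open import Function using (_∘_; id)
open import Relation.Binary.PropositionalEquality
open import Relation.Binary.Definitions using (tri<; tri≈; tri>)
open import Relation.Nullary using (¬_; yes; no; contradiction)

<ᵇ-true : ∀ {x y} → x < y → (x <ᵇ y) ≡ true
<ᵇ-true {zero}  {suc y} _         = refl
<ᵇ-true {suc x} {suc y} (s≤s x<y) = <ᵇ-true x<y

<ᵇ-false : ∀ {x y} → y ≤ x → (x <ᵇ y) ≡ false
<ᵇ-false {y = zero}      _         = refl
<ᵇ-false {suc x} {suc y} (s≤s y≤x) = <ᵇ-false y≤x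

≤ᵇ-true : ∀ {x y} → x ≤ y → (x ≤ᵇ y) ≡ true
≤ᵇ-true z≤n       = refl
≤ᵇ-true (s≤s x≤y) = <ᵇ-true (s≤s x≤y)

≤ᵇ-false : ∀ {x y} → y < x → (x ≤ᵇ y) ≡ false
≤ᵇ-false (s≤s y≤x) = <ᵇ-false y≤x

infix 4 _≺_

-- A data type rather than lexLt s t ≡ true, so that s and t can be inferred from a proof.

data _≺_ (s t : Str) : Set where
  lexLt≡true : lexLt s t ≡ true → s ≺ t

lexLt≡false⇒⊀ : ∀ {s t} → lexLt s t ≡ false → ¬ s ≺ t
lexLt≡false⇒⊀ s⊀t (lexLt≡true s≺t) with () ← trans (sym s≺t) s⊀t

lexLt-∷ : ∀ x xs ys → lexLt (x ∷ xs) (x ∷ ys) ≡ lexLt xs ys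
lexLt-∷ x xs ys rewrite <ᵇ-false (≤-refl {x}) = refl

≺-∷⁺ : ∀ {x xs ys} → xs ≺ ys → x ∷ xs ≺ x ∷ ys
≺-∷⁺ {x} {xs} {ys} (lexLt≡true xs≺ys) = lexLt≡true (trans (lexLt-∷ x xs ys) xs≺ys)

≺-∷⁻ : ∀ {x xs ys} → x ∷ xs ≺ x ∷ ys → xs ≺ ys
≺-∷⁻ {x} {xs} {ys} (lexLt≡true x∷xs≺x∷ys) = lexLt≡true (trans (sym (lexLt-∷ x xs ys)) x∷xs≺x∷ys)

⊀-∷⁺ : ∀ {x xs ys} → ¬ xs ≺ ys → ¬ x ∷ xs ≺ x ∷ ys
⊀-∷⁺ xs⊀ys = xs⊀ys ∘ ≺-∷⁻

≺-head< : ∀ {x y} xs ys → x < y → x ∷ xs ≺ y ∷ ys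
≺-head< {x} {y} xs ys x<y = lexLt≡true lexLt-true
  where
  lexLt-true : lexLt (x ∷ xs) (y ∷ ys) ≡ true
  lexLt-true rewrite <ᵇ-true x<y = refl

⊀-head> : ∀ {x y} xs ys → y < x → ¬ x ∷ xs ≺ y ∷ ys
⊀-head> {x} {y} xs ys y<x = lexLt≡false⇒⊀ lexLt-false
  where
  lexLt-false : lexLt (x ∷ xs) (y ∷ ys) ≡ false
  lexLt-false rewrite <ᵇ-false (<⇒≤ y<x) | <ᵇ-true y<x = refl

≺-irrefl : ∀ xs → ¬ xs ≺ xs
≺-irrefl []       (lexLt≡true ())
≺-irrefl (x ∷ xs) = ⊀-∷⁺ (≺-irrefl xs)

≺-asym : ∀ s t → s ≺ t → ¬ t ≺ s
≺-asym []      []      (lexLt≡true ())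
≺-asym []      (y ∷ t) _ (lexLt≡true ())
≺-asym (x ∷ s) []      (lexLt≡true ())
≺-asym (x ∷ s) (y ∷ t) s≺t with <-cmp x y
... | tri< x<y _ _  = ⊀-head> t s x<y
... | tri≈ _ refl _ = ⊀-∷⁺ (≺-asym s t (≺-∷⁻ s≺t))
... | tri> _ _ y<x  = contradiction s≺t (⊀-head> s t y<x)

lcp-∷ : ∀ x xs ys → lcp (x ∷ xs) (x ∷ ys) ≡ suc (lcp xs ys)
lcp-∷ x xs ys rewrite <ᵇ-false (≤-refl {x}) = refl

lcp-≢ : ∀ {x y} xs ys → x ≢ y → lcp (x ∷ xs) (y ∷ ys) ≡ 0
lcp-≢ {x} {y} xs ys x≢y with <-cmp x y
... | tri< x<y _ _ rewrite <ᵇ-true x<y = refl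
... | tri≈ _ x≡y _ = contradiction x≡y x≢y
... | tri> _ _ y<x rewrite <ᵇ-false (<⇒≤ y<x) | <ᵇ-true y<x = refl

length≤lcp-++ : ∀ xs {ys zs} → length xs ≤ lcp (xs ++ ys) (xs ++ zs)
length≤lcp-++ []                = z≤n
length≤lcp-++ (x ∷ xs) {ys} {zs} rewrite lcp-∷ x (xs ++ ys) (xs ++ zs) = s≤s (length≤lcp-++ xs)

≺⇒lcp<length : ∀ t cur → t ≺ cur → lcp cur t < length cur
≺⇒lcp<length []      []        (lexLt≡true ())
≺⇒lcp<length (x ∷ t) []        (lexLt≡true ())
≺⇒lcp<length []      (c ∷ cur) _ = s≤s z≤n
≺⇒lcp<length (x ∷ t) (c ∷ cur) t≺cur with c ≟ x
... | no c≢x   rewrite lcp-≢ cur t c≢x = s≤s z≤n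
... | yes refl rewrite lcp-∷ c cur t = s≤s (≺⇒lcp<length t cur (≺-∷⁻ t≺cur))

-- This is why the lexicographic predecessor of cur shares the longest prefix with cur
-- among all smaller strings.
lcp-mono : ∀ s b cur → ¬ b ≺ s → b ≺ cur → lcp cur s ≤ lcp cur b
lcp-mono []      b       []        _   _ = z≤n
lcp-mono []      b       (c ∷ cur) _   _ = z≤n
lcp-mono (y ∷ s) []      cur       b⊀s _ = contradiction (lexLt≡true refl) b⊀s
lcp-mono (y ∷ s) (x ∷ b) []        _   (lexLt≡true ())
lcp-mono (y ∷ s) (x ∷ b) (c ∷ cur) b⊀s b≺cur with c ≟ y
... | no c≢y rewrite lcp-≢ cur s c≢y = z≤n
... | yes refl with <-cmp x c
...   | tri< x<c _ _  = contradiction (≺-head< b s x<c) b⊀s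
...   | tri> _ _ c<x  = contradiction b≺cur (⊀-head> b cur c<x)
...   | tri≈ _ refl _ rewrite lcp-∷ x cur s | lcp-∷ x cur b =
  s≤s (lcp-mono s b cur (b⊀s ∘ ≺-∷⁺) (≺-∷⁻ b≺cur))

LcpBound : ℕ → Str → Str → Set
LcpBound L cur t = t ≺ cur → lcp cur t ≤ L

lcpBound-⊀ : ∀ {L cur t} → ¬ t ≺ cur → LcpBound L cur t
lcpBound-⊀ t⊀cur t≺cur = contradiction t≺cur t⊀cur

data LcpMaximal (cur : Str) (cands : List Str) : Maybe Str → Set where
  none : All (λ s → ¬ s ≺ cur) cands → LcpMaximal cur cands nothing
  some : ∀ {b} → b ≺ cur → b ∈ cands → All (LcpBound (lcp cur b) cur) cands →
         LcpMaximal cur cands (just b)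

predecessor-lcpMaximal : ∀ cur cands → LcpMaximal cur cands (predecessor cur cands)
predecessor-lcpMaximal cur [] = none []
predecessor-lcpMaximal cur (s ∷ cands)
  with predecessor cur cands | predecessor-lcpMaximal cur cands | lexLt s cur in s?cur
... | nothing | none ⊀cur | false = none (lexLt≡false⇒⊀ s?cur ∷ ⊀cur)
... | nothing | none ⊀cur | true  =
  some (lexLt≡true s?cur) (here refl) ((λ _ → ≤-refl) ∷ All.map (λ t⊀ t≺ → contradiction t≺ t⊀) ⊀cur)
... | just b  | some b≺cur b∈ bound | false =
  some b≺cur (there b∈) (lcpBound-⊀ (lexLt≡false⇒⊀ s?cur) ∷ bound)
... | just b  | some b≺cur b∈ bound | true with lexLt b s in b?s
...   | true  = some (lexLt≡true s?cur) (here refl) ((λ _ → ≤-refl) ∷ All.map (λ t≤b t≺ → ≤-trans (t≤b t≺) b≤s) bound)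
  where
  b≤s : lcp cur b ≤ lcp cur s
  b≤s = lcp-mono b s cur (≺-asym b s (lexLt≡true b?s)) (lexLt≡true s?cur)
...   | false = some b≺cur (there b∈) ((λ _ → lcp-mono s b cur (lexLt≡false⇒⊀ b?s) b≺cur) ∷ bound)

-- ellAt s i is lcpPred (suffixes s) (drop i s) by definition.
lcpPred : List Str → Str → ℕ
lcpPred cands cur = maybe (lcp cur) 0 (predecessor cur cands)

lcpPred-≤ : ∀ {L} cands cur → All (LcpBound L cur) cands → lcpPred cands cur ≤ L
lcpPred-≤ cands cur bounds with predecessor cur cands | predecessor-lcpMaximal cur cands
... | nothing | none _         = z≤n
... | just b  | some b≺cur b∈ _ = lookup bounds b∈ b≺cur

lcp≤lcpPred : ∀ {t} cands cur → t ∈ cands → t ≺ cur → lcp cur t ≤ lcpPred cands cur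
lcp≤lcpPred cands cur t∈ t≺cur with predecessor cur cands | predecessor-lcpMaximal cur cands
... | nothing | none ⊀cur     = contradiction t≺cur (lookup ⊀cur t∈)
... | just b  | some _ _ bound = lookup bound t∈ t≺cur

lcpPred≤length : ∀ cands x xs → lcpPred cands (x ∷ xs) ≤ length xs
lcpPred≤length cands x xs =
  lcpPred-≤ cands (x ∷ xs) (universal (λ t t≺ → ≤-pred (≺⇒lcp<length t (x ∷ xs) t≺)) cands)

lcpBound-refl : ∀ {L} cur → LcpBound L cur cur
lcpBound-refl cur = lcpBound-⊀ (≺-irrefl cur)

lcpBound-∷ : ∀ {L} x {xs ys} → LcpBound L xs ys → LcpBound (suc L) (x ∷ xs) (x ∷ ys)
lcpBound-∷ x {xs} {ys} bound ys≺xs rewrite lcp-∷ x xs ys = s≤s (bound (≺-∷⁻ ys≺xs))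

lcpBound-head : ∀ {L x y xs ys} → (x ≡ y → LcpBound L (x ∷ xs) (y ∷ ys)) → LcpBound L (x ∷ xs) (y ∷ ys)
lcpBound-head {x = x} {y} {xs} {ys} same with x ≟ y
... | yes x≡y = same x≡y
... | no x≢y rewrite lcp-≢ xs ys x≢y = λ _ → z≤n

suffixes-∷ : ∀ x xs → suffixes (x ∷ xs) ≡ (x ∷ xs) ∷ suffixes xs
suffixes-∷ x xs = cong ((x ∷ xs) ∷_)
  (trans (map-applyUpTo suc (λ i → drop i (x ∷ xs)) (length xs))
         (sym (map-applyUpTo id (λ i → drop i xs) (length xs))))

All-suffixes-∷⁺ : ∀ {P : Str → Set} {x xs} → P (x ∷ xs) → All P (suffixes xs) → All P (suffixes (x ∷ xs))
All-suffixes-∷⁺ {P} {x} {xs} p ps = subst (All P) (sym (suffixes-∷ x xs)) (p ∷ ps)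

∈-suffixes-∷⁺ : ∀ {t x xs} → t ∈ suffixes xs → t ∈ suffixes (x ∷ xs)
∈-suffixes-∷⁺ {t} {x} {xs} t∈ = subst (t ∈_) (sym (suffixes-∷ x xs)) (there t∈)

∈-suffixes-self : ∀ x xs → x ∷ xs ∈ suffixes (x ∷ xs)
∈-suffixes-self x xs = subst (x ∷ xs ∈_) (sym (suffixes-∷ x xs)) (here refl)

∈-suffixes-++⁺ʳ : ∀ {t xs} ys → t ∈ suffixes xs → t ∈ suffixes (ys ++ xs)
∈-suffixes-++⁺ʳ []       t∈ = t∈
∈-suffixes-++⁺ʳ (y ∷ ys) t∈ = ∈-suffixes-∷⁺ (∈-suffixes-++⁺ʳ ys t∈)

down : ℕ → Str
down = applyDownFrom suc

downPairs : ℕ → Str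
downPairs zero    = []
downPairs (suc k) = suc (suc k) ∷ suc k ∷ downPairs k

All-suffixes-down++ : ∀ {P : Str → Set} k X →
  (∀ j → P (down (suc j) ++ X)) → All P (suffixes X) → All P (suffixes (down k ++ X))
All-suffixes-down++ zero    X pD pX = pX
All-suffixes-down++ (suc k) X pD pX = All-suffixes-∷⁺ (pD k) (All-suffixes-down++ k X pD pX)

All-suffixes-downPairs : ∀ {P : Str → Set} k →
  (∀ j → P (downPairs (suc j))) → (∀ j → P (suc j ∷ downPairs j)) → All P (suffixes (downPairs k))
All-suffixes-downPairs zero    pQ pB = []
All-suffixes-downPairs (suc k) pQ pB =
  All-suffixes-∷⁺ (pQ k) (All-suffixes-∷⁺ (pB k) (All-suffixes-downPairs k pQ pB))

down++-∈-suffixes : ∀ {j k} X → j ≤′ k → down (suc j) ++ X ∈ suffixes (down (suc k) ++ X)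
down++-∈-suffixes X ≤′-refl          = ∈-suffixes-self _ _
down++-∈-suffixes X (≤′-step j≤′k) = ∈-suffixes-∷⁺ (down++-∈-suffixes X j≤′k)

downPairs1-∈-suffixes : ∀ k → downPairs 1 ∈ suffixes (downPairs (suc k))
downPairs1-∈-suffixes zero    = ∈-suffixes-self _ _
downPairs1-∈-suffixes (suc k) = ∈-suffixes-∷⁺ (∈-suffixes-∷⁺ (downPairs1-∈-suffixes k))

ascendingPair : ℕ → Str
ascendingPair i = suc i ∷ suc (suc i) ∷ []

reverse-concat-ascendingPairs : ∀ k → reverse (concat (applyUpTo ascendingPair k)) ≡ downPairs k
reverse-concat-ascendingPairs zero    = refl
reverse-concat-ascendingPairs (suc k) = begin
  reverse (concat (applyUpTo ascendingPair (suc k)))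
    ≡⟨ cong (reverse ∘ concat) (applyUpTo-∷ʳ ascendingPair k) ⟨
  reverse (concat (applyUpTo ascendingPair k ∷ʳ ascendingPair k))
    ≡⟨ cong reverse (concat-++ (applyUpTo ascendingPair k) (ascendingPair k ∷ [])) ⟨
  reverse (concat (applyUpTo ascendingPair k) ++ ascendingPair k)
    ≡⟨ reverse-++ (concat (applyUpTo ascendingPair k)) (ascendingPair k) ⟩
  reverse (ascendingPair k) ++ reverse (concat (applyUpTo ascendingPair k))
    ≡⟨ cong (reverse (ascendingPair k) ++_) (reverse-concat-ascendingPairs k) ⟩
  downPairs (suc k) ∎
  where open ≡-Reasoning

reverse-w : ∀ σ → reverse (w σ) ≡ down σ ++ downPairs (σ ∸ 1)
reverse-w σ = begin
  reverse (w σ)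
    ≡⟨ reverse-++ (concatMap ascendingPair (upTo (σ ∸ 1))) (map suc (upTo σ)) ⟩
  reverse (map suc (upTo σ)) ++ reverse (concat (map ascendingPair (upTo (σ ∸ 1))))
    ≡⟨ cong₂ (λ xs xss → reverse xs ++ reverse (concat xss)) (map-upTo suc σ) (map-upTo ascendingPair (σ ∸ 1)) ⟩
  reverse (applyUpTo suc σ) ++ reverse (concat (applyUpTo ascendingPair (σ ∸ 1)))
    ≡⟨ cong₂ _++_ (reverse-applyUpTo suc σ) (reverse-concat-ascendingPairs (σ ∸ 1)) ⟩
  down σ ++ downPairs (σ ∸ 1) ∎
  where open ≡-Reasoning

drop≡∷⇒< : ∀ (s : Str) i {x xs} → drop i s ≡ x ∷ xs → i < length s
drop≡∷⇒< []      zero    ()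
drop≡∷⇒< []      (suc i) ()
drop≡∷⇒< (y ∷ s) zero    _  = s≤s z≤n
drop≡∷⇒< (y ∷ s) (suc i) at = s≤s (drop≡∷⇒< s i at)

drop≡[]⇒≤ : ∀ (s : Str) i → drop i s ≡ [] → length s ≤ i
drop≡[]⇒≤ []      i       _  = z≤n
drop≡[]⇒≤ (y ∷ s) zero    ()
drop≡[]⇒≤ (y ∷ s) (suc i) at = s≤s (drop≡[]⇒≤ s i at)

drop-+ : ∀ (s : Str) i d {xs} → drop i s ≡ xs → drop (i + d) s ≡ drop d xs
drop-+ s i d at = trans (sym (drop-drop i d s)) (cong (drop d) at)

parseFrom-phrase : ∀ (s : Str) f i {x xs} d → drop i s ≡ x ∷ xs → 1 ⊔ lcpPred (suffixes s) (x ∷ xs) ≡ d →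
                   parseFrom s (suc f) i ≡ suc (parseFrom s f (i + d))
parseFrom-phrase s f i _ at refl =
  trans (if-cong (≤ᵇ-false (drop≡∷⇒< s i at)))
        (cong (λ cur → suc (parseFrom s f (i + (1 ⊔ lcpPred (suffixes s) cur)))) at)

parseFrom-end : ∀ (s : Str) f i → drop i s ≡ [] → parseFrom s f i ≡ 0
parseFrom-end s zero    i _  = refl
parseFrom-end s (suc f) i at = if-cong (≤ᵇ-true (drop≡[]⇒≤ s i at))

length-downPairs : ∀ k → length (downPairs k) ≡ k + k
length-downPairs zero    = refl
length-downPairs (suc k) = cong suc (trans (cong suc (length-downPairs k)) (sym (+-suc k k)))

module Reversed (m : ℕ) where

  σ : ℕ
  σ = 2 + m

  pairs : Str
  pairs = downPairs (suc m)

  wᴿ : Str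
  wᴿ = down σ ++ pairs

  All-suffixes-wᴿ : ∀ {P : Str → Set} →
    (∀ j → P (down (suc j) ++ pairs)) → (∀ j → P (downPairs (suc j))) → (∀ j → P (suc j ∷ downPairs j)) →
    All P (suffixes wᴿ)
  All-suffixes-wᴿ pD pQ pB = All-suffixes-down++ σ pairs pD (All-suffixes-downPairs (suc m) pQ pB)

  lcpPred-down≥3 : ∀ k → lcpPred (suffixes wᴿ) (down (3 + k) ++ pairs) ≤ 1
  lcpPred-down≥3 k = lcpPred-≤ (suffixes wᴿ) (down (3 + k) ++ pairs) (All-suffixes-wᴿ
    (λ _ → lcpBound-head λ { refl → lcpBound-refl _ })
    (λ _ → lcpBound-head λ { refl → lcpBound-⊀ (⊀-∷⁺ (⊀-∷⁺ (⊀-head> _ _ ≤-refl))) })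
    (λ _ → lcpBound-head λ { refl → lcpBound-∷ _ (lcpBound-head λ ()) }))

  lcpPred-down2 : lcpPred (suffixes wᴿ) (down 2 ++ pairs) ≡ 2
  lcpPred-down2 = ≤-antisym
    (lcpPred-≤ (suffixes wᴿ) (down 2 ++ pairs) (All-suffixes-wᴿ
      (λ _ → lcpBound-head λ { refl → lcpBound-refl _ })
      (λ _ → lcpBound-head λ { refl _ → ≤-refl })
      (λ _ → lcpBound-head λ { refl → lcpBound-∷ _ (lcpBound-head λ ()) })))
    (lcp≤lcpPred (suffixes wᴿ) (down 2 ++ pairs) (∈-suffixes-++⁺ʳ (down σ) (downPairs1-∈-suffixes m)) (lexLt≡true refl))

  lcpPred-downPairs≥2 : ∀ j → suc j ≤ m → lcpPred (suffixes wᴿ) (downPairs (2 + j)) ≡ 2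
  lcpPred-downPairs≥2 j j<m = ≤-antisym
    (lcpPred-≤ (suffixes wᴿ) (downPairs (2 + j)) (All-suffixes-wᴿ
      (λ _ → lcpBound-head λ { refl → lcpBound-∷ _ (lcpBound-∷ _ (lcpBound-head λ ())) })
      (λ _ → lcpBound-head λ { refl → lcpBound-refl _ })
      (λ _ → lcpBound-head λ { refl → lcpBound-∷ _ (lcpBound-head λ ()) })))
    (≤-trans (length≤lcp-++ (3 + j ∷ 2 + j ∷ []) {downPairs (suc j)} {down (1 + j) ++ pairs})
             (lcp≤lcpPred (suffixes wᴿ) (downPairs (2 + j))
                          (down++-∈-suffixes pairs (≤⇒≤′ (s≤s j<m)))
                          (≺-∷⁺ (≺-∷⁺ (≺-head< _ _ ≤-refl)))))

  -- The fuel is (number of phrases) + e, so that each phrase consumes one suc of it.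
  parse-downPairs : ∀ j e i → j ≤ m → drop i wᴿ ≡ downPairs (suc j) → parseFrom wᴿ (2 + j + e) i ≡ 2 + j
  parse-downPairs zero e i _ at = begin
    parseFrom wᴿ (2 + e) i
      ≡⟨ parseFrom-phrase wᴿ (1 + e) i 1 at (m≥n⇒m⊔n≡m (lcpPred≤length (suffixes wᴿ) 2 (1 ∷ []))) ⟩
    1 + parseFrom wᴿ (1 + e) (i + 1)
      ≡⟨ cong suc (parseFrom-phrase wᴿ e (i + 1) 1 at₁ (m≥n⇒m⊔n≡m (≤-trans (lcpPred≤length (suffixes wᴿ) 1 []) z≤n))) ⟩
    2 + parseFrom wᴿ e (i + 1 + 1)
      ≡⟨ cong (2 +_) (parseFrom-end wᴿ e (i + 1 + 1) (drop-+ wᴿ (i + 1) 1 at₁)) ⟩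
    2 ∎
    where
    open ≡-Reasoning
    at₁ : drop (i + 1) wᴿ ≡ 1 ∷ []
    at₁ = drop-+ wᴿ i 1 at
  parse-downPairs (suc j) e i j<m at = begin
    parseFrom wᴿ (3 + j + e) i
      ≡⟨ parseFrom-phrase wᴿ (2 + j + e) i 2 at (cong (1 ⊔_) (lcpPred-downPairs≥2 j j<m)) ⟩
    1 + parseFrom wᴿ (2 + j + e) (i + 2)
      ≡⟨ cong suc (parse-downPairs j e (i + 2) (<⇒≤ j<m) (drop-+ wᴿ i 2 at)) ⟩
    3 + j ∎
    where open ≡-Reasoning

  parse-down : ∀ k e i → drop i wᴿ ≡ down (2 + k) ++ pairs → parseFrom wᴿ (suc k + σ + e) i ≡ suc k + σ
  parse-down zero e i at = begin
    parseFrom wᴿ (1 + σ + e) i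
      ≡⟨ parseFrom-phrase wᴿ (σ + e) i 2 at (cong (1 ⊔_) lcpPred-down2) ⟩
    1 + parseFrom wᴿ (σ + e) (i + 2)
      ≡⟨ cong suc (parse-downPairs m e (i + 2) ≤-refl (drop-+ wᴿ i 2 at)) ⟩
    1 + σ ∎
    where open ≡-Reasoning
  parse-down (suc k) e i at = begin
    parseFrom wᴿ (2 + k + σ + e) i
      ≡⟨ parseFrom-phrase wᴿ (1 + k + σ + e) i 1 at (m≥n⇒m⊔n≡m (lcpPred-down≥3 k)) ⟩
    1 + parseFrom wᴿ (1 + k + σ + e) (i + 1)
      ≡⟨ cong suc (parse-down k e (i + 1) (drop-+ wᴿ i 1 at)) ⟩
    2 + k + σ ∎
    where open ≡-Reasoning

  length-wᴿ : length wᴿ ≡ suc m + σ + suc m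
  length-wᴿ = begin
    length (down σ ++ pairs)        ≡⟨ length-++ (down σ) ⟩
    length (down σ) + length pairs  ≡⟨ cong₂ _+_ (length-applyDownFrom suc σ) (length-downPairs (suc m)) ⟩
    σ + (suc m + suc m)             ≡⟨ +-assoc σ (suc m) (suc m) ⟨
    σ + suc m + suc m               ≡⟨ cong (_+ suc m) (+-comm σ (suc m)) ⟩
    suc m + σ + suc m               ∎
    where open ≡-Reasoning

lemma5p8 : ∀ (σ : ℕ) → 2 ≤ σ → 2 ∣ σ → v (reverse (w σ)) ≡ 2 * σ ∸ 1
lemma5p8 (suc zero)    (s≤s ()) _
lemma5p8 (suc (suc m)) _        _ = begin
  v (reverse (w σ))                   ≡⟨ cong v (reverse-w σ) ⟩
  parseFrom wᴿ (length wᴿ) 0          ≡⟨ cong (λ f → parseFrom wᴿ f 0) length-wᴿ ⟩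
  parseFrom wᴿ (suc m + σ + suc m) 0  ≡⟨ parse-down m (suc m) 0 refl ⟩
  suc m + σ                           ≡⟨ cong (suc m +_) (+-identityʳ σ) ⟨
  2 * σ ∸ 1                           ∎
  where
  open Reversed m
  open ≡-Reasoning
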